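{- Let $a,\delta$ be positive integers with $a<\delta<2a$ and $\gcd(a,\delta)=1$, put $b=a+\delta$ and $d=\delta-a$. For $n\ge 0$ let $w_n = n + a\lfloor n/a\rfloor + b\lfloor n/\delta\rfloor$ and $\mathcal W_0=\{w_n:n\ge 0\}$. Let $n=qa+r\ge a$ with $0\le r<a$. If $r<d$ and $w_n-\delta\notin\mathcal W_0$, then $(w_n-\delta)-b\in\mathcal W_0$ (in particular $w_n-\delta-b\ge 0$). -}

module Defs where

open import Data.Nat using (ℕ; suc; _+_; _*_; _/_; NonZero)
open import Data.Integer using (ℤ; +_)
open import Data.Product using (∃)
open import Relation.Binary.PropositionalEquality using (_≡_)

w : (a δ : ℕ) → .{{NonZero a}} → .{{NonZero δ}} → ℕ → ℕ
w a δ n = n + a * (n / a) + (a + δ) * (n / δ)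

InW₀ : (a δ : ℕ) → .{{NonZero a}} → .{{NonZero δ}} → ℤ → Set
InW₀ a δ m = ∃ λ (k : ℕ) → + (w a δ k) ≡ m

-- Put d = δ − a and k = n − d.  As r < d < a (the latter from δ < 2a), going from k to n
-- crosses exactly one multiple of a, and as d < δ at most one multiple of δ; hence
-- w_n = w_k + δ + j·b with j ∈ {0, 1}, and j = 0 would put w_n − δ = w_k in W₀.
module Submission where

open import Defs
open import Data.Nat using (ℕ; zero; suc; _+_; _*_; _∸_; _<_; _≤_; _/_; NonZero; s≤s)
open import Data.Nat.GCD using (gcd)
import Data.Nat.Properties as ℕ
open import Data.Nat.DivMod using (+-distrib-/-∣ˡ; m*n/n≡m; m<n⇒m/n≡0; /-monoˡ-≤; m/n≡1+[m∸n]/n)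
open import Data.Nat.Divisibility using (n∣m*n)
open import Data.Nat.Tactic.RingSolver using (solve)
open import Data.Integer using (+_; _-_)
import Data.Integer.Properties as ℤ
open import Algebra.Properties.AbelianGroup ℤ.+-0-abelianGroup using (//-rightDividesʳ)
open import Data.List using (_∷_; [])
open import Data.Product using (∃; _,_)
open import Data.Sum as Sum using (_⊎_; inj₁; inj₂)
open import Relation.Nullary using (¬_; contradiction)
open import Relation.Binary.PropositionalEquality using (_≡_; sym; trans; cong; cong₂; module ≡-Reasoning)
open ≡-Reasoning

[m*n+o]/n≡m : ∀ m {n o} .{{_ : NonZero n}} → o < n → (m * n + o) / n ≡ m
[m*n+o]/n≡m m {n} {o} o<n = begin
  (m * n + o) / n    ≡⟨ +-distrib-/-∣ˡ o (n∣m*n m) ⟩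
  m * n / n + o / n  ≡⟨ cong₂ _+_ (m*n/n≡m m n) (m<n⇒m/n≡0 o<n) ⟩
  m + 0              ≡⟨ ℕ.+-identityʳ m ⟩
  m                  ∎

o≤n⇒[m+o]/n≡m/n⊎1+m/n : ∀ m {n o} .{{_ : NonZero n}} → o ≤ n →
                        (m + o) / n ≡ m / n ⊎ (m + o) / n ≡ suc (m / n)
o≤n⇒[m+o]/n≡m/n⊎1+m/n m {n} {o} o≤n with ℕ.m≤n⇒m<n∨m≡n upper
  where
  [m+n]/n≡1+m/n : (m + n) / n ≡ suc (m / n)
  [m+n]/n≡1+m/n = trans (m/n≡1+[m∸n]/n (ℕ.m≤n+m n m)) (cong (λ x → suc (x / n)) (ℕ.m+n∸n≡m m n))
  upper : (m + o) / n ≤ suc (m / n)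
  upper = ℕ.≤-trans (/-monoˡ-≤ n (ℕ.+-monoʳ-≤ m o≤n)) (ℕ.≤-reflexive [m+n]/n≡1+m/n)
... | inj₁ (s≤s ≤m/n) = inj₁ (ℕ.≤-antisym ≤m/n (/-monoˡ-≤ n (ℕ.m≤m+n m o)))
... | inj₂ ≡1+m/n     = inj₂ ≡1+m/n

+[m+n]-+n≡+m : ∀ m n → + (m + n) - + n ≡ + m
+[m+n]-+n≡+m m n = trans (cong (_- + n) (ℤ.pos-+ m n)) (//-rightDividesʳ (+ n) (+ m))

w-+ : ∀ a δ .{{_ : NonZero a}} .{{_ : NonZero δ}} k d i j →
      (k + d) / a ≡ i + k / a → (k + d) / δ ≡ j + k / δ →
      w a δ (k + d) ≡ w a δ k + (a + δ) * j + (d + a * i)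
w-+ a δ k d i j [k+d]/a [k+d]/δ = begin
  k + d + a * ((k + d) / a) + (a + δ) * ((k + d) / δ)
    ≡⟨ cong₂ (λ x y → k + d + a * x + (a + δ) * y) [k+d]/a [k+d]/δ ⟩
  k + d + a * (i + k / a) + (a + δ) * (j + k / δ)
    ≡⟨ regroup (k / a) (k / δ) ⟩
  k + a * (k / a) + (a + δ) * (k / δ) + (a + δ) * j + (d + a * i)
    ∎
  where
  regroup : ∀ x y → k + d + a * (i + x) + (a + δ) * (j + y)
                  ≡ k + a * x + (a + δ) * y + (a + δ) * j + (d + a * i)
  regroup x y = solve (k ∷ d ∷ a ∷ δ ∷ i ∷ j ∷ x ∷ y ∷ [])

wₙ≡wₖ+δ⊎wₖ+b+δ : ∀ a δ .{{_ : NonZero a}} .{{_ : NonZero δ}} → a < δ → δ < 2 * a →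
                  ∀ p {r} → r < a → r < δ ∸ a →
                  ∃ λ k → w a δ (suc p * a + r) ≡ w a δ k + δ
                        ⊎ w a δ (suc p * a + r) ≡ w a δ k + (a + δ) + δ
wₙ≡wₖ+δ⊎wₖ+b+δ a δ a<δ δ<2a p {r} r<a r<d =
  k , Sum.map wₙ≡wₖ+δ wₙ≡wₖ+b+δ (o≤n⇒[m+o]/n≡m/n⊎1+m/n k (ℕ.m∸n≤m δ a))
  where
  d = δ ∸ a
  d<a : d < a
  d<a = ℕ.m<n+o⇒m∸n<o δ a (ℕ.<-≤-trans δ<2a (ℕ.≤-reflexive (cong (λ x → a + x) (ℕ.+-identityʳ a))))
  d≤a+r : d ≤ a + r
  d≤a+r = ℕ.≤-trans (ℕ.<⇒≤ d<a) (ℕ.m≤m+n a r)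
  s = a + r ∸ d
  k = p * a + s
  n≡k+d : suc p * a + r ≡ k + d
  n≡k+d = begin
    suc p * a + r   ≡⟨ solve (p ∷ a ∷ r ∷ []) ⟩
    p * a + (a + r) ≡⟨ cong (λ x → p * a + x) (ℕ.m∸n+n≡m d≤a+r) ⟨
    p * a + (s + d) ≡⟨ ℕ.+-assoc (p * a) s d ⟨
    k + d           ∎
  s<a : s < a
  s<a = ℕ.m<n+o⇒m∸n<o (a + r) d (ℕ.<-≤-trans (ℕ.+-monoʳ-< a r<d) (ℕ.≤-reflexive (ℕ.+-comm a d)))
  [k+d]/a≡1+k/a : (k + d) / a ≡ 1 + k / a
  [k+d]/a≡1+k/a = begin
    (k + d) / a         ≡⟨ cong (_/ a) n≡k+d ⟨
    (suc p * a + r) / a ≡⟨ [m*n+o]/n≡m (suc p) r<a ⟩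
    suc p               ≡⟨ cong suc ([m*n+o]/n≡m p s<a) ⟨
    1 + k / a           ∎
  d+a≡δ : d + a * 1 ≡ δ
  d+a≡δ = trans (cong (λ x → d + x) (ℕ.*-identityʳ a)) (ℕ.m∸n+n≡m (ℕ.<⇒≤ a<δ))
  wₙ≡wₖ+bj+δ : ∀ j → (k + d) / δ ≡ j + k / δ → w a δ (suc p * a + r) ≡ w a δ k + (a + δ) * j + δ
  wₙ≡wₖ+bj+δ j [k+d]/δ = begin
    w a δ (suc p * a + r)               ≡⟨ cong (w a δ) n≡k+d ⟩
    w a δ (k + d)                       ≡⟨ w-+ a δ k d 1 j [k+d]/a≡1+k/a [k+d]/δ ⟩
    w a δ k + (a + δ) * j + (d + a * 1) ≡⟨ cong (λ x → w a δ k + (a + δ) * j + x) d+a≡δ ⟩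
    w a δ k + (a + δ) * j + δ           ∎
  wₙ≡wₖ+δ : (k + d) / δ ≡ k / δ → w a δ (suc p * a + r) ≡ w a δ k + δ
  wₙ≡wₖ+δ same = trans (wₙ≡wₖ+bj+δ 0 same)
    (cong (_+ δ) (trans (cong (λ x → w a δ k + x) (ℕ.*-zeroʳ (a + δ))) (ℕ.+-identityʳ (w a δ k))))
  wₙ≡wₖ+b+δ : (k + d) / δ ≡ 1 + k / δ → w a δ (suc p * a + r) ≡ w a δ k + (a + δ) + δ
  wₙ≡wₖ+b+δ next = trans (wₙ≡wₖ+bj+δ 1 next)
    (cong (λ x → w a δ k + x + δ) (ℕ.*-identityʳ (a + δ)))

lemma3p4 : (a δ : ℕ) → .{{_ : NonZero a}} → .{{_ : NonZero δ}} →
           a < δ → δ < 2 * a → gcd a δ ≡ 1 →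
           (q r : ℕ) → r < a → a ≤ q * a + r →
           r < δ ∸ a →
           ¬ InW₀ a δ (+ w a δ (q * a + r) - + δ) →
           InW₀ a δ ((+ w a δ (q * a + r) - + δ) - + (a + δ))
lemma3p4 a δ _ _ _ zero r r<a a≤r _ _ = contradiction a≤r (ℕ.<⇒≱ r<a)
lemma3p4 a δ a<δ δ<2a _ (suc p) r r<a _ r<d wₙ-δ∉W₀
  with wₙ≡wₖ+δ⊎wₖ+b+δ a δ a<δ δ<2a p r<a r<d
... | k , inj₁ wₙ≡wₖ+δ = contradiction (k , sym (begin
  + w a δ (suc p * a + r) - + δ ≡⟨ cong (λ x → + x - + δ) wₙ≡wₖ+δ ⟩
  + (w a δ k + δ) - + δ         ≡⟨ +[m+n]-+n≡+m (w a δ k) δ ⟩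
  + w a δ k                     ∎)) wₙ-δ∉W₀
... | k , inj₂ wₙ≡wₖ+b+δ = k , sym (begin
  + w a δ (suc p * a + r) - + δ - + (a + δ)  ≡⟨ cong (λ x → + x - + δ - + (a + δ)) wₙ≡wₖ+b+δ ⟩
  + (w a δ k + (a + δ) + δ) - + δ - + (a + δ) ≡⟨ cong (_- + (a + δ)) (+[m+n]-+n≡+m (w a δ k + (a + δ)) δ) ⟩
  + (w a δ k + (a + δ)) - + (a + δ)          ≡⟨ +[m+n]-+n≡+m (w a δ k) (a + δ) ⟩
  + w a δ k                                  ∎)
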